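{- Let $D$ be a finite digraph. If every induced subdigraph of $D$ has a semi-kernel, then $D$ has a semi-Grundy function.
   Context: All digraphs are finite. For a vertex $x$ of a digraph $D$, $\Gamma^+(x)$ denotes the set of out-neighbours of $x$. A function $s:V(D)\to\mathbb{N}$ (with $\mathbb{N}=\{0,1,2,\dots\}$) is a semi-Grundy function of $D$ if (1) whenever $s(x)=k$, every $y\in\Gamma^+(x)$ satisfies $s(y)\neq k$; and (2) whenever $s(x)=k$, $y\in\Gamma^+(x)$ and $s(y)>k$, there exists $z\in\Gamma^+(y)$ with $s(z)=k$. A set $I\subseteq V(D)$ is independent if no arc of $D$ has both ends in $I$. A semi-kernel of $D$ is an independent set $S\subseteq V(D)$ such that for every vertex $z$, if there is an arc from a vertex of $S$ to $z$, then there is an arc from $z$ to some vertex of $S$. -}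

module Defs where

open import Data.Nat using (ℕ; _<_)
open import Data.Fin using (Fin)
open import Data.Fin.Subset using (Subset; _∈_; _⊆_; Nonempty)
open import Data.Bool using (Bool; true; false)
open import Data.Product using (Σ; ∃; _×_; _,_)
open import Relation.Binary.PropositionalEquality using (_≡_; _≢_)
open import Relation.Nullary using (¬_)

record Digraph : Set where
  field
    n        : ℕ
    arc      : Fin n → Fin n → Bool
    loopless : ∀ x → arc x x ≡ false

open Digraph public

VSet : Digraph → Set
VSet D = Subset (n D)

Arc : (D : Digraph) → Fin (n D) → Fin (n D) → Set
Arc D x y = arc D x y ≡ true

-- semi-kernel of the induced subdigraph D[U]
-- (S ⊆ U, S nonempty, S independent, and every vertex z of U receiving an
--  arc from S sends an arc to S)
IsSemiKernelIn : (D : Digraph) → VSet D → VSet D → Set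
IsSemiKernelIn D U S =
  S ⊆ U
  × Nonempty S
  × (∀ x y → x ∈ S → y ∈ S → ¬ Arc D x y)
  × (∀ x z → x ∈ S → z ∈ U → Arc D x z → ∃ λ y → y ∈ S × Arc D z y)

EveryInducedHasSemiKernel : Digraph → Set
EveryInducedHasSemiKernel D =
  (U : VSet D) → Nonempty U → ∃ λ S → IsSemiKernelIn D U S

IsSemiGrundy : (D : Digraph) → (Fin (n D) → ℕ) → Set
IsSemiGrundy D s =
  (∀ x y → Arc D x y → s y ≢ s x)
  × (∀ x y → Arc D x y → s x < s y → ∃ λ z → Arc D y z × s z ≡ s x)

module Submission where

-- Proof idea (peeling off semi-kernels).  We build, for every vertex set U,
-- a function s that is a semi-Grundy function of the induced subdigraph D[U],
-- by strong induction on |U|.  Otherwise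
-- D[U] has a semi-kernel S; by induction D[U ─ S] has a semi-Grundy function
-- s', and we give value 0 to the vertices of S and value 1 + s' x to every
-- other vertex x.  Independence of S makes this proper inside S, the shift by
-- one separates S from the rest, and an arc x → y with s x < s y is answered
-- either by the semi-kernel property of S (when x ∈ S) or by s' (otherwise).

open import Defs
open import Data.Nat using (ℕ; suc; _<_; s≤s; s<s⁻¹)
open import Data.Nat.Properties using (0≢1+n; suc-injective; <-irrefl; <-≤-trans; n≮0)
open import Data.Fin using (Fin)
open import Data.Fin.Subset using (Subset; _∈_; _∉_; _─_; ⊤; ∣_∣; Empty; inside; outside)
open import Data.Fin.Subset.Properties
  using (_∈?_; nonempty?; x∈p∧x∉q⇒x∈p─q; p─q⊆p; p∩q≢∅⇒∣p─q∣<∣p∣; x∈p∩q⁺; ∈⊤; ∣p∣≤n)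
open import Data.Vec using (_∷_; here; there)
open import Data.Product using (Σ; ∃; _×_; _,_; proj₁; proj₂)
open import Data.Empty using (⊥-elim)
open import Relation.Nullary using (yes; no)
open import Relation.Binary.PropositionalEquality using (_≡_; _≢_; refl; sym; cong)

x∈p─q⇒x∉q : ∀ {k} {x : Fin k} (p q : Subset k) → x ∈ p ─ q → x ∉ q
x∈p─q⇒x∉q (inside  ∷ p) (inside ∷ q) ()        here
x∈p─q⇒x∉q (outside ∷ p) (inside ∷ q) ()        here
x∈p─q⇒x∉q (_       ∷ p) (_      ∷ q) (there a) (there b) = x∈p─q⇒x∉q p q a b

module _ (D : Digraph) where

  V : Set
  V = Fin (n D)

  IsSemiGrundyOn : VSet D → (V → ℕ) → Set
  IsSemiGrundyOn U s =
    (∀ x y → x ∈ U → y ∈ U → Arc D x y → s y ≢ s x)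
    × (∀ x y → x ∈ U → y ∈ U → Arc D x y → s x < s y →
         ∃ λ z → z ∈ U × Arc D y z × s z ≡ s x)

  semiGrundyOn-empty : ∀ {U} (s : V → ℕ) → Empty U → IsSemiGrundyOn U s
  semiGrundyOn-empty s empty =
    (λ x _ x∈U _ _ _ → empty (x , x∈U)) , (λ x _ x∈U _ _ _ → ⊥-elim (empty (x , x∈U)))

  semiGrundyOn-⊤ : ∀ {s} → IsSemiGrundyOn ⊤ s → IsSemiGrundy D s
  semiGrundyOn-⊤ {s} (proper , absorbing) =
    (λ x y a → proper x y ∈⊤ ∈⊤ a) ,
    (λ x y a lt → forget (absorbing x y ∈⊤ ∈⊤ a lt))
    where
    forget : ∀ {x y} → (∃ λ z → z ∈ ⊤ × Arc D y z × s z ≡ s x) → ∃ λ z → Arc D y z × s z ≡ s x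
    forget (z , _ , a , eq) = z , a , eq

  layer : Subset (n D) → (V → ℕ) → V → ℕ
  layer S s' x with x ∈? S
  ... | yes _ = 0
  ... | no  _ = suc (s' x)

  module _ {U S : VSet D} {s' : V → ℕ}
           (kernel : IsSemiKernelIn D U S) (rest : IsSemiGrundyOn (U ─ S) s') where

    private
      S⊆U         = proj₁ kernel
      independent = proj₁ (proj₂ (proj₂ kernel))
      absorbs     = proj₂ (proj₂ (proj₂ kernel))

    layer-proper : ∀ x y → x ∈ U → y ∈ U → Arc D x y → layer S s' y ≢ layer S s' x
    layer-proper x y x∈U y∈U a with x ∈? S | y ∈? S
    ... | yes x∈S | yes y∈S = λ _ → independent x y x∈S y∈S a
    ... | yes _   | no  _   = λ eq → 0≢1+n (sym eq)
    ... | no  _   | yes _   = 0≢1+n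
    ... | no  x∉S | no  y∉S = λ eq →
      proj₁ rest x y (x∈p∧x∉q⇒x∈p─q x∈U x∉S) (x∈p∧x∉q⇒x∈p─q y∈U y∉S) a
        (suc-injective eq)

    layer-absorbing : ∀ x y → x ∈ U → y ∈ U → Arc D x y → layer S s' x < layer S s' y →
      ∃ λ z → z ∈ U × Arc D y z × layer S s' z ≡ layer S s' x
    layer-absorbing x y x∈U y∈U a lt with x ∈? S | y ∈? S
    ... | yes _   | yes _   = ⊥-elim (<-irrefl refl lt)
    ... | no  _   | yes _   = ⊥-elim (n≮0 lt)
    ... | yes x∈S | no  _   with absorbs x y x∈S y∈U a
    ...   | z , z∈S , a′ = z , S⊆U z∈S , a′ , at-zero z∈S
      where
      at-zero : ∀ {z} → z ∈ S → layer S s' z ≡ 0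
      at-zero {z} z∈S with z ∈? S
      ... | yes _   = refl
      ... | no  z∉S = ⊥-elim (z∉S z∈S)
    layer-absorbing x y x∈U y∈U a lt | no x∉S | no y∉S
      with proj₂ rest x y (x∈p∧x∉q⇒x∈p─q x∈U x∉S) (x∈p∧x∉q⇒x∈p─q y∈U y∉S) a
             (s<s⁻¹ lt)
    ... | z , z∈U─S , a′ , eq = z , p─q⊆p U S z∈U─S , a′ , shifted (x∈p─q⇒x∉q U S z∈U─S)
      where
      shifted : z ∉ S → layer S s' z ≡ suc (s' x)
      shifted z∉S with z ∈? S
      ... | yes z∈S = ⊥-elim (z∉S z∈S)
      ... | no  _   = cong suc eq

    layer-semiGrundyOn : IsSemiGrundyOn U (layer S s')
    layer-semiGrundyOn = layer-proper , layer-absorbing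

  -- Every induced subdigraph has a semi-Grundy function, by induction on a
  -- bound m for its size; removing a nonempty semi-kernel strictly shrinks U.
  semiGrundyOn : EveryInducedHasSemiKernel D →
    (m : ℕ) (U : VSet D) → ∣ U ∣ < m → Σ (V → ℕ) (IsSemiGrundyOn U)
  semiGrundyOn hyp (suc m) U (s≤s |U|≤m) with nonempty? U
  ... | no  empty = (λ _ → 0) , semiGrundyOn-empty (λ _ → 0) empty
  ... | yes U≠∅ with hyp U U≠∅
  ...   | S , kernel@(S⊆U , (w , w∈S) , _) with
            semiGrundyOn hyp m (U ─ S)
              (<-≤-trans (p∩q≢∅⇒∣p─q∣<∣p∣ U S (w , x∈p∩q⁺ (S⊆U w∈S , w∈S))) |U|≤m)
  ...     | s' , rest = layer S s' , layer-semiGrundyOn kernel rest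

proposition1 : (D : Digraph) → EveryInducedHasSemiKernel D →
    Σ (Fin (n D) → ℕ) (IsSemiGrundy D)
proposition1 D hyp with semiGrundyOn D hyp (suc (n D)) ⊤ (s≤s (∣p∣≤n ⊤))
... | s , semiGrundy-on-V = s , semiGrundyOn-⊤ D semiGrundy-on-V
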